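{- Let $k\geq 2$ and $J\geq 0$ be integers, let $j\geq J+1$ and $i,l\in\{1,\dots,k\}$, and let ${}^J_ih^{(j)}_l(q)$ be as in the context. Then ${}^J_ih^{(j)}_l(q)=\sum_\lambda q^{|\lambda|}$, the sum over all partitions $\lambda=(b_1,\dots,b_s)$, $b_1\geq\cdots\geq b_s$, such that $b_p-b_{p+k-1}\geq 2$ whenever $p+k-1\leq s$, the smallest part is greater than $J$, the part $J+1$ appears at most $k-i$ times, the largest part is at most $j$, and the part $j$ appears exactly $l-1$ times.
   Context: $q$ is a formal variable. Fix $k\geq 2$. For each integer $j\geq 1$ let $\mathbf{A}_{(j)}$ be the $k\times k$ matrix whose $(r,c)$ entry is $q^{j(c-1)}$ if $c\leq k-r+1$ and $0$ otherwise (so its first row is $(1,q^j,q^{2j},\dots,q^{(k-1)j})$ and its last row is $(1,0,\dots,0)$). For an integer $J\geq 0$ let ${}^J\mathbf{h}^{(J)}$ be the identity matrix and ${}^J\mathbf{h}^{(j)}=\mathbf{A}_{(J+1)}\mathbf{A}_{(J+2)}\cdots\mathbf{A}_{(j)}$ for $j>J$; let ${}^J_ih^{(j)}_l(q)$ denote its $(i,l)$ entry. The empty partition is allowed (size $0$). -}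

module Defs where

open import Data.Nat using (ℕ; zero; suc; _+_; _*_; _∸_; _≤_; _<_; _≥_; _≟_; _<?_)
open import Data.Fin using (Fin; toℕ) renaming (zero to fzero; suc to fsuc)
open import Data.List using (List; []; _∷_; map; upTo; length; lookup; filter)
open import Data.Nat.ListAction using (sum)
open import Data.List.Relation.Unary.All using (All)
open import Data.List.Relation.Unary.Linked using (Linked)
open import Data.Product using (_×_)
open import Relation.Nullary.Decidable using (does)
open import Data.Bool using (if_then_else_)
open import Relation.Binary.PropositionalEquality using (_≡_)

-- Formal power series in q with natural-number coefficients,
-- represented by their coefficient function (n ↦ coefficient of q^n).
Series : Set
Series = ℕ → ℕ

zeroS : Series
zeroS _ = 0

oneS : Series
oneS n = if does (n ≟ 0) then 1 else 0

monomial : ℕ → Series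
monomial e n = if does (n ≟ e) then 1 else 0

_+S_ : Series → Series → Series
(f +S g) n = f n + g n

_*S_ : Series → Series → Series
(f *S g) n = sum (map (λ a → f a * g (n ∸ a)) (upTo (suc n)))

-- k × k matrices of series, indices 0-based (Fin k)
Mat : ℕ → Set
Mat k = Fin k → Fin k → Series

sumFin : ∀ {n} → (Fin n → Series) → Series
sumFin {zero}  f = zeroS
sumFin {suc n} f = f fzero +S sumFin (λ x → f (fsuc x))

idMat : ∀ k → Mat k
idMat k r c = if does (toℕ r ≟ toℕ c) then oneS else zeroS

_·_ : ∀ {k} → Mat k → Mat k → Mat k
(M · N) r c = sumFin (λ m → M r m *S N m c)

-- A_(j): 1-based entry (r,c) is q^{j(c-1)} if c ≤ k-r+1, else 0.
-- With 0-based r0 = r-1, c0 = c-1 the condition is c0 + r0 < k.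
A : ∀ k → ℕ → Mat k
A k j r c = if does (toℕ c + toℕ r <? k) then monomial (j * toℕ c) else zeroS

hprod : ∀ k → ℕ → ℕ → Mat k
hprod k J zero    = idMat k
hprod k J (suc d) = hprod k J d · A k (suc (J + d))

h : ∀ k → ℕ → ℕ → Mat k
h k J j = hprod k J (j ∸ J)

mult : ℕ → List ℕ → ℕ
mult m xs = length (filter (_≟ m) xs)

-- Partitions are lists of parts b_1 ≥ b_2 ≥ ... ≥ b_s ≥ 1; |λ| = sum.
-- The partitions counted in Proposition B.2, with i = toℕ i0 + 1, l = toℕ l0 + 1.
record Counted (k J j : ℕ) (i0 l0 : Fin k) (λs : List ℕ) : Set where
  field
    decreasing : Linked _≥_ λs
    positive   : All (1 ≤_) λs
    -- b_p - b_{p+k-1} ≥ 2 whenever p + k - 1 ≤ s (0-based positions p, r = p + k - 1)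
    gap        : ∀ (p r : Fin (length λs)) → toℕ r ≡ toℕ p + (k ∸ 1) →
                 lookup λs r + 2 ≤ lookup λs p
    smallest   : All (J <_) λs
    multJ+1    : mult (suc J) λs ≤ k ∸ suc (toℕ i0)
    largest    : All (_≤ j) λs
    multj      : mult j λs ≡ toℕ l0

module Submission where

-- Write v = J + d + 1.  A partition counted by the (r, c) entry at level d+1
-- (parts in (J, v], exactly c parts equal to v) is c copies of v followed by a
-- partition counted at level d whose number m of parts equal to v - 1 satisfies
-- c + m < k; conversely every such concatenation is counted.  The inequality
-- c + m < k is exactly what the window condition b_p - b_(p+k-1) ≥ 2 says about
-- the two largest values, and at level 0 the row index r takes the role of m.
-- This mirrors the recursion  h^(d+1)(r,c) = Σ_m h^(d)(r,m) · [c + m < k] q^(v c).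

open import Defs
open import Data.Bool using (if_then_else_)
open import Data.Empty using (⊥-elim)
open import Data.Fin using (Fin; toℕ; fromℕ<) renaming (zero to fzero; suc to fsuc)
open import Data.Fin.Properties using (toℕ-fromℕ<; toℕ<n; toℕ-injective)
open import Data.List using (List; []; _∷_; _++_; map; length; lookup; replicate; applyUpTo; concat; tabulate; filter)
open import Data.List.Properties using (length-++; length-map; length-replicate; ++-cancelˡ; map-applyUpTo; filter-all; filter-none; filter-++)
open import Data.List.Membership.Propositional using (_∈_)
open import Data.List.Membership.Propositional.Properties using (∈-map⁺; ∈-map⁻; ∈-concat⁺; ∈-concat⁻)
open import Data.List.Relation.Unary.All using (All; []; _∷_) renaming (map to All-map; head to All-head)
open import Data.List.Relation.Unary.All.Properties using (replicate⁺; ++⁺; ++⁻ʳ) renaming (tabulate⁺ to All-tabulate⁺)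
open import Data.List.Relation.Unary.AllPairs using ([]; _∷_)
open import Data.List.Relation.Unary.AllPairs.Properties using () renaming (tabulate⁺ to AllPairs-tabulate⁺)
open import Data.List.Relation.Unary.Any using (here)
open import Data.List.Relation.Unary.Any.Properties using () renaming (tabulate⁺ to Any-tabulate⁺; tabulate⁻ to Any-tabulate⁻)
open import Data.List.Relation.Unary.Linked using (Linked; []; [-]; _∷_) renaming (tail to Linked-tail)
open import Data.List.Relation.Unary.Linked.Properties using (Linked⇒All)
open import Data.List.Relation.Unary.Unique.Propositional using (Unique)
import Data.List.Relation.Unary.Unique.Propositional.Properties as Unique
open import Data.Nat
open import Data.Nat.Properties
open import Data.Nat.ListAction using (sum)
open import Data.Product using (Σ; _×_; _,_; proj₁; proj₂; uncurry)
open import Function using (_∘_; id)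
open import Function.Bundles using (_⇔_; mk⇔)
open import Relation.Nullary using (¬_; Dec; yes; no)
open import Relation.Nullary.Decidable using (does; dec-true; dec-false)
open import Relation.Binary.PropositionalEquality

sum-applyUpTo-zero : ∀ N (φ : ℕ → ℕ) → (∀ a → a < N → φ a ≡ 0) → sum (applyUpTo φ N) ≡ 0
sum-applyUpTo-zero zero    φ vanish = refl
sum-applyUpTo-zero (suc N) φ vanish =
  cong₂ _+_ (vanish 0 z<s) (sum-applyUpTo-zero N (φ ∘ suc) (λ a a<N → vanish (suc a) (s<s a<N)))

sum-applyUpTo-single : ∀ N (φ : ℕ → ℕ) t → t < N → (∀ a → a < N → a ≢ t → φ a ≡ 0) →
  sum (applyUpTo φ N) ≡ φ t
sum-applyUpTo-single (suc N) φ zero _ vanish =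
  trans (cong (φ 0 +_) (sum-applyUpTo-zero N (φ ∘ suc) (λ a a<N → vanish (suc a) (s<s a<N) λ ())))
        (+-identityʳ (φ 0))
sum-applyUpTo-single (suc N) φ (suc t) (s<s t<N) vanish =
  cong₂ _+_ (vanish 0 z<s λ ())
            (sum-applyUpTo-single N (φ ∘ suc) t t<N
              (λ a a<N a≢t → vanish (suc a) (s<s a<N) (a≢t ∘ suc-injective)))

*S-as-sum : ∀ f g n → (f *S g) n ≡ sum (applyUpTo (λ a → f a * g (n ∸ a)) (suc n))
*S-as-sum f g n = cong sum (map-applyUpTo id (λ a → f a * g (n ∸ a)) (suc n))

monomial-on : ∀ e → monomial e e ≡ 1
monomial-on e rewrite dec-true (e ≟ e) refl = refl

monomial-off : ∀ e n → n ≢ e → monomial e n ≡ 0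
monomial-off e n n≢e rewrite dec-false (n ≟ e) n≢e = refl

*S-zeroS : ∀ f n → (f *S zeroS) n ≡ 0
*S-zeroS f n = trans (*S-as-sum f zeroS n) (sum-applyUpTo-zero (suc n) _ (λ a _ → *-zeroʳ (f a)))

*S-monomial-≤ : ∀ f e n → e ≤ n → (f *S monomial e) n ≡ f (n ∸ e)
*S-monomial-≤ f e n e≤n = begin
  (f *S monomial e) n                     ≡⟨ *S-as-sum f (monomial e) n ⟩
  sum (applyUpTo term (suc n))            ≡⟨ sum-applyUpTo-single (suc n) term (n ∸ e) (s≤s (m∸n≤m n e)) off ⟩
  f (n ∸ e) * monomial e (n ∸ (n ∸ e))    ≡⟨ cong (λ x → f (n ∸ e) * monomial e x) (m∸[m∸n]≡n e≤n) ⟩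
  f (n ∸ e) * monomial e e                ≡⟨ cong (f (n ∸ e) *_) (monomial-on e) ⟩
  f (n ∸ e) * 1                           ≡⟨ *-identityʳ (f (n ∸ e)) ⟩
  f (n ∸ e)                               ∎
  where
  open ≡-Reasoning
  term : ℕ → ℕ
  term a = f a * monomial e (n ∸ a)
  off : ∀ a → a < suc n → a ≢ n ∸ e → term a ≡ 0
  off a (s≤s a≤n) a≢ = trans (cong (f a *_) (monomial-off e (n ∸ a) n∸a≢e)) (*-zeroʳ (f a))
    where
    n∸a≢e : n ∸ a ≢ e
    n∸a≢e eq = a≢ (trans (sym (m∸[m∸n]≡n a≤n)) (cong (n ∸_) eq))

*S-monomial-≰ : ∀ f e n → ¬ e ≤ n → (f *S monomial e) n ≡ 0
*S-monomial-≰ f e n e≰n = trans (*S-as-sum f (monomial e) n) (sum-applyUpTo-zero (suc n) _ off)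
  where
  off : ∀ a → a < suc n → f a * monomial e (n ∸ a) ≡ 0
  off a _ = trans (cong (f a *_) (monomial-off e (n ∸ a) λ eq → e≰n (subst (_≤ n) eq (m∸n≤m n a))))
                  (*-zeroʳ (f a))

guard : ∀ {P : Set} {X : Set} → Dec P → List X → List X
guard P? xs = if does P? then xs else []

length-guard : ∀ {P X : Set} (P? : Dec P) (xs : List X) →
  length (guard P? xs) ≡ (if does P? then length xs else 0)
length-guard (yes _) xs = refl
length-guard (no _)  xs = refl

length-guard-series : ∀ {P X : Set} (P? : Dec P) (xs : List X) (s : Series) n →
  length xs ≡ s n → length (guard P? xs) ≡ (if does P? then s else zeroS) n
length-guard-series (yes _) xs s n eq = eq
length-guard-series (no _)  xs s n eq = refl

length-guard-*S : ∀ {P X : Set} (P? : Dec P) (xs : List X) (f s : Series) n →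
  length xs ≡ (f *S s) n → length (guard P? xs) ≡ (f *S (if does P? then s else zeroS)) n
length-guard-*S (yes _) xs f s n eq = eq
length-guard-*S (no _)  xs f s n eq = sym (*S-zeroS f n)

length-guard-shift : ∀ {X : Set} {e n} (e≤?n : Dec (e ≤ n)) (xs : List X) (f : Series) →
  length xs ≡ f (n ∸ e) → length (guard e≤?n xs) ≡ (f *S monomial e) n
length-guard-shift {e = e} {n} (yes e≤n) xs f eq = trans eq (sym (*S-monomial-≤ f e n e≤n))
length-guard-shift {e = e} {n} (no e≰n)  xs f eq = sym (*S-monomial-≰ f e n e≰n)

∈-guard⁻ : ∀ {P X : Set} (P? : Dec P) {xs : List X} {x} → x ∈ guard P? xs → P × x ∈ xs
∈-guard⁻ (yes p) x∈ = p , x∈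

∈-guard⁺ : ∀ {P X : Set} (P? : Dec P) {xs : List X} {x} → P → x ∈ xs → x ∈ guard P? xs
∈-guard⁺ (yes _) p x∈ = x∈
∈-guard⁺ (no ¬p) p x∈ = ⊥-elim (¬p p)

Unique-guard : ∀ {P X : Set} (P? : Dec P) {xs : List X} → Unique xs → Unique (guard P? xs)
Unique-guard (yes _) u = u
Unique-guard (no _)  u = []

concatFin : ∀ {N} {X : Set} → (Fin N → List X) → List X
concatFin F = concat (tabulate F)

length-concatFin : ∀ {N X} (F : Fin N → List X) (s : Fin N → Series) n →
  (∀ m → length (F m) ≡ s m n) → length (concatFin F) ≡ sumFin s n
length-concatFin {zero}  F s n eq = refl
length-concatFin {suc N} F s n eq =
  trans (length-++ (F fzero)) (cong₂ _+_ (eq fzero) (length-concatFin (F ∘ fsuc) (s ∘ fsuc) n (eq ∘ fsuc)))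

∈-concatFin⁻ : ∀ {N X} (F : Fin N → List X) {x} → x ∈ concatFin F → Σ (Fin N) λ m → x ∈ F m
∈-concatFin⁻ F x∈ = Any-tabulate⁻ (∈-concat⁻ (tabulate F) x∈)

∈-concatFin⁺ : ∀ {N X} (F : Fin N → List X) {x} m → x ∈ F m → x ∈ concatFin F
∈-concatFin⁺ F m x∈ = ∈-concat⁺ (Any-tabulate⁺ m x∈)

Unique-concatFin : ∀ {N X} (F : Fin N → List X) → (∀ m → Unique (F m)) →
  (∀ m₁ m₂ {x} → x ∈ F m₁ → x ∈ F m₂ → m₁ ≡ m₂) → Unique (concatFin F)
Unique-concatFin F unique disjoint =
  Unique.concat⁺ (All-tabulate⁺ unique)
                 (AllPairs-tabulate⁺ (λ m₁≢m₂ (x∈₁ , x∈₂) → m₁≢m₂ (disjoint _ _ x∈₁ x∈₂)))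

-- The entry at position i (0-based), defaulting to 0 past the end.
at : List ℕ → ℕ → ℕ
at []       i       = 0
at (x ∷ xs) zero    = x
at (x ∷ xs) (suc i) = at xs i

lookup-at : ∀ xs (i : Fin (length xs)) → lookup xs i ≡ at xs (toℕ i)
lookup-at (x ∷ xs) fzero    = refl
lookup-at (x ∷ xs) (fsuc i) = lookup-at xs i

All-at : ∀ {P : ℕ → Set} xs {i} → All P xs → i < length xs → P (at xs i)
All-at (x ∷ xs) {zero}  (px ∷ _)   _         = px
All-at (x ∷ xs) {suc i} (_  ∷ pxs) (s<s i<n) = All-at xs pxs i<n

+-split : ∀ a b {n} → a + b ≡ n → a ≤ n × b ≡ n ∸ a
+-split a b a+b≡n = subst (a ≤_) a+b≡n (m≤m+n a b) , trans (sym (m+n∸m≡n a b)) (cong (_∸ a) a+b≡n)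

sum-replicate-++ : ∀ c v μ → sum (replicate c v ++ μ) ≡ v * c + sum μ
sum-replicate-++ zero    v μ = cong (_+ sum μ) (sym (*-zeroʳ v))
sum-replicate-++ (suc c) v μ = begin
  v + sum (replicate c v ++ μ) ≡⟨ cong (v +_) (sum-replicate-++ c v μ) ⟩
  v + (v * c + sum μ)          ≡⟨ sym (+-assoc v (v * c) (sum μ)) ⟩
  v + v * c + sum μ            ≡⟨ cong (_+ sum μ) (sym (*-suc v c)) ⟩
  v * suc c + sum μ            ∎
  where open ≡-Reasoning

mult-++ : ∀ x xs ys → mult x (xs ++ ys) ≡ mult x xs + mult x ys
mult-++ x xs ys = trans (cong length (filter-++ (_≟ x) xs ys)) (length-++ (filter (_≟ x) xs))

mult-replicate : ∀ c v → mult v (replicate c v) ≡ c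
mult-replicate c v = trans (cong length (filter-all (_≟ v) (replicate⁺ c refl))) (length-replicate c)

mult-absent : ∀ x xs → All (_≢ x) xs → mult x xs ≡ 0
mult-absent x xs absent = cong length (filter-none (_≟ x) absent)

mult-top : ∀ c {v μ} → All (_< v) μ → mult v (replicate c v ++ μ) ≡ c
mult-top c {v} {μ} μ<v = begin
  mult v (replicate c v ++ μ)           ≡⟨ mult-++ v (replicate c v) μ ⟩
  mult v (replicate c v) + mult v μ     ≡⟨ cong₂ _+_ (mult-replicate c v) (mult-absent v μ (All-map <⇒≢ μ<v)) ⟩
  c + 0                                 ≡⟨ +-identityʳ c ⟩
  c                                     ∎
  where open ≡-Reasoning

mult-below : ∀ c {v x} μ → v ≢ x → mult x (replicate c v ++ μ) ≡ mult x μ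
mult-below c {v} {x} μ v≢x =
  trans (mult-++ x (replicate c v) μ)
        (cong (_+ mult x μ) (mult-absent x (replicate c v) (replicate⁺ c v≢x)))

Linked-++ʳ : ∀ {R : ℕ → ℕ → Set} xs {ys} → Linked R (xs ++ ys) → Linked R ys
Linked-++ʳ []       L = L
Linked-++ʳ (x ∷ xs) L = Linked-++ʳ xs (Linked-tail L)

Linked-replicate-++ : ∀ c {v μ} → Linked _≥_ μ → All (_≤ v) μ → Linked _≥_ (replicate c v ++ μ)
Linked-replicate-++ zero                      L μ≤v       = L
Linked-replicate-++ (suc zero)    {μ = []}    L μ≤v       = [-]
Linked-replicate-++ (suc zero)    {μ = _ ∷ _} L (y≤v ∷ _) = y≤v ∷ L
Linked-replicate-++ (suc (suc c))             L μ≤v       = ≤-refl ∷ Linked-replicate-++ (suc c) L μ≤v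

split-top : ∀ v xs → Linked _≥_ xs → All (_≤ v) xs →
  Σ ℕ λ c → Σ (List ℕ) λ μ → xs ≡ replicate c v ++ μ × All (_< v) μ
split-top v []       _ _ = 0 , [] , refl , []
split-top v (x ∷ xs) L (x≤v ∷ xs≤v) with x ≟ v
... | yes refl with split-top v xs (Linked-tail L) xs≤v
...   | c , μ , refl , μ<v = suc c , μ , refl , μ<v
split-top v (x ∷ xs) L (x≤v ∷ _) | no x≢v =
  0 , x ∷ xs , refl , All-map (λ y≤x → ≤-<-trans y≤x (≤∧≢⇒< x≤v x≢v)) (Linked⇒All ≥-trans ≤-refl L)
  where
  ≥-trans : ∀ {a b c} → a ≥ b → b ≥ c → a ≥ c
  ≥-trans a≥b b≥c = ≤-trans b≥c a≥b

GapAt : ℕ → List ℕ → Set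
GapAt g xs = ∀ (p r : Fin (length xs)) → toℕ r ≡ toℕ p + g → lookup xs r + 2 ≤ lookup xs p

data Gap (g : ℕ) : List ℕ → Set where
  []  : Gap g []
  _∷_ : ∀ {x xs} → (g < length (x ∷ xs) → at (x ∷ xs) g + 2 ≤ x) → Gap g xs → Gap g (x ∷ xs)

GapAt⇒Gap : ∀ g xs → GapAt g xs → Gap g xs
GapAt⇒Gap g []       G = []
GapAt⇒Gap g (x ∷ xs) G = window ∷ GapAt⇒Gap g xs (λ p r e → G (fsuc p) (fsuc r) (cong suc e))
  where
  window : g < length (x ∷ xs) → at (x ∷ xs) g + 2 ≤ x
  window g<len = subst (λ a → a + 2 ≤ x)
    (trans (lookup-at (x ∷ xs) (fromℕ< g<len)) (cong (at (x ∷ xs)) (toℕ-fromℕ< g<len)))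
    (G fzero (fromℕ< g<len) (toℕ-fromℕ< g<len))

Gap⇒GapAt : ∀ {g xs} → Gap g xs → GapAt g xs
Gap⇒GapAt {g} {x ∷ xs} (window ∷ _) fzero r r≡g =
  subst (λ a → a + 2 ≤ x) (sym (trans (lookup-at (x ∷ xs) r) (cong (at (x ∷ xs)) r≡g)))
        (window (subst (_< suc (length xs)) r≡g (toℕ<n r)))
Gap⇒GapAt (_ ∷ G) (fsuc p) (fsuc r) e = Gap⇒GapAt G p r (suc-injective e)

Gap-++ʳ : ∀ {g} xs {ys} → Gap g (xs ++ ys) → Gap g ys
Gap-++ʳ []       G       = G
Gap-++ʳ (x ∷ xs) (_ ∷ G) = Gap-++ʳ xs G

Gap-head : ∀ {g xs} → Gap g xs → g < length xs → at xs g + 2 ≤ at xs 0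
Gap-head (window ∷ _) g<len = window g<len

-- Lists with c parts w+1, then m parts w, then the parts ν: the shape of a
-- counted partition near its two largest admissible values.
blocks : ℕ → ℕ → ℕ → List ℕ → List ℕ
blocks c m w ν = replicate c (suc w) ++ replicate m w ++ ν

length-blocks : ∀ c m w ν → length (blocks c m w ν) ≡ c + m + length ν
length-blocks zero    zero    w ν = refl
length-blocks zero    (suc m) w ν = cong suc (length-blocks zero m w ν)
length-blocks (suc c) m       w ν = cong suc (length-blocks c m w ν)

at-blocks-past : ∀ c m w ν i → c + m ≤ i → at (blocks c m w ν) i ≡ at ν (i ∸ (c + m))
at-blocks-past zero    zero    w ν i       _         = refl
at-blocks-past zero    (suc m) w ν (suc i) (s≤s le) = at-blocks-past zero m w ν i le
at-blocks-past (suc c) m       w ν (suc i) (s≤s le) = at-blocks-past c m w ν i le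

at-blocks-within : ∀ c m w ν i → i < c + m →
  w ≤ at (blocks c m w ν) i × at (blocks c m w ν) i ≤ suc w
at-blocks-within zero    (suc m) w ν zero    _         = ≤-refl , n≤1+n w
at-blocks-within zero    (suc m) w ν (suc i) (s<s lt) = at-blocks-within zero m w ν i lt
at-blocks-within (suc c) m       w ν zero    _         = n≤1+n w , ≤-refl
at-blocks-within (suc c) m       w ν (suc i) (s<s lt) = at-blocks-within c m w ν i lt

-- The window condition forces c + m ≤ g: otherwise position g holds w or w+1
-- while position 0 holds at most w+1.
gap-bound : ∀ {g} c m w ν → Gap g (blocks c m w ν) → c + m ≤ g
gap-bound {g} c m w ν G with c + m ≤? g
... | yes c+m≤g = c+m≤g
... | no c+m≰g = ⊥-elim (1+n≰n (subst (_≤ suc w) (+-comm w 2) (begin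
    w + 2         ≤⟨ +-monoˡ-≤ 2 (proj₁ (at-blocks-within c m w ν g g<c+m)) ⟩
    at xs g + 2   ≤⟨ Gap-head G g<len ⟩
    at xs 0       ≤⟨ proj₂ (at-blocks-within c m w ν 0 (≤-trans (s≤s z≤n) g<c+m)) ⟩
    suc w         ∎)))
  where
  open ≤-Reasoning
  xs : List ℕ
  xs = blocks c m w ν
  g<c+m : g < c + m
  g<c+m = ≰⇒> c+m≰g
  g<len : g < length xs
  g<len = subst (g <_) (sym (length-blocks c m w ν)) (≤-trans g<c+m (m≤m+n (c + m) (length ν)))

-- Conversely, if c + m ≤ g, prepending c parts w+1 to (w^m, ν) with ν < w keeps
-- the window condition: the entry g places after a new part lies inside ν.
gap-prepend : ∀ {g} c m w ν → Gap g (blocks 0 m w ν) → All (_< w) ν → c + m ≤ g → Gap g (blocks c m w ν)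
gap-prepend zero    m w ν G ν<w _ = G
gap-prepend {g} (suc c) m w ν G ν<w c+m≤g =
  window ∷ gap-prepend c m w ν G ν<w (≤-trans (n≤1+n (c + m)) c+m≤g)
  where
  window : g < length (blocks (suc c) m w ν) → at (blocks (suc c) m w ν) g + 2 ≤ suc w
  window g<len = subst (λ a → a + 2 ≤ suc w) (sym (at-blocks-past (suc c) m w ν g c+m≤g))
                       (subst (_≤ suc w) (+-comm 2 a) (s≤s (All-at ν ν<w index<len)))
    where
    a : ℕ
    a = at ν (g ∸ (suc c + m))
    index<len : g ∸ (suc c + m) < length ν
    index<len = subst (g ∸ (suc c + m) <_) (m+n∸m≡n (suc c + m) (length ν))
      (∸-monoˡ-< (subst (g <_) (length-blocks (suc c) m w ν) g<len) c+m≤g)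

module Enumeration (g J : ℕ) where

  k : ℕ
  k = suc g

  open Counted

  top≢J+1 : ∀ {w} → J < w → suc w ≢ suc J
  top≢J+1 J<w e = <⇒≢ J<w (sym (suc-injective e))

  counted-shape : ∀ w r c λs → Counted k J (suc w) r c λs →
    Σ ℕ λ m₀ → Σ (List ℕ) λ ν → λs ≡ blocks (toℕ c) m₀ w ν × All (_< w) ν
  counted-shape w r c λs C with split-top (suc w) λs (decreasing C) (largest C)
  ... | c₀ , μ , refl , μ≤w with trans (sym (mult-top c₀ μ≤w)) (multj C)
  ... | refl with split-top w μ (Linked-++ʳ (replicate c₀ (suc w)) (decreasing C)) (All-map ≤-pred μ≤w)
  ... | m₀ , ν , refl , ν<w = m₀ , ν , refl , ν<w

  peel : ∀ w → J < w → ∀ r c λs → Counted k J (suc w) r c λs →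
    Σ (Fin k) λ m → Σ (List ℕ) λ μ →
      toℕ c + toℕ m < k × λs ≡ replicate (toℕ c) (suc w) ++ μ × Counted k J w r m μ
  peel w J<w r c λs C with counted-shape w r c λs C
  ... | m₀ , ν , refl , ν<w = fromℕ< m₀<k , replicate m₀ w ++ ν , c+m<k , refl , rest
    where
    G : Gap g (blocks (toℕ c) m₀ w ν)
    G = GapAt⇒Gap g _ (gap C)
    c+m₀≤g : toℕ c + m₀ ≤ g
    c+m₀≤g = gap-bound (toℕ c) m₀ w ν G
    m₀<k : m₀ < k
    m₀<k = s≤s (≤-trans (m≤n+m m₀ (toℕ c)) c+m₀≤g)
    c+m<k : toℕ c + toℕ (fromℕ< m₀<k) < k
    c+m<k = s≤s (subst (λ x → toℕ c + x ≤ g) (sym (toℕ-fromℕ< m₀<k)) c+m₀≤g)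
    rest : Counted k J w r (fromℕ< m₀<k) (replicate m₀ w ++ ν)
    rest = record
      { decreasing = Linked-++ʳ (replicate (toℕ c) (suc w)) (decreasing C)
      ; positive   = ++⁻ʳ (replicate (toℕ c) (suc w)) (positive C)
      ; gap        = Gap⇒GapAt (Gap-++ʳ (replicate (toℕ c) (suc w)) G)
      ; smallest   = ++⁻ʳ (replicate (toℕ c) (suc w)) (smallest C)
      ; multJ+1    = subst (_≤ g ∸ toℕ r) (mult-below (toℕ c) _ (top≢J+1 J<w)) (multJ+1 C)
      ; largest    = ++⁺ (replicate⁺ m₀ ≤-refl) (All-map <⇒≤ ν<w)
      ; multj      = trans (mult-top m₀ ν<w) (sym (toℕ-fromℕ< m₀<k))
      }

  glue : ∀ w → J < w → ∀ r c m μ → toℕ c + toℕ m < k → Counted k J w r m μ →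
    Counted k J (suc w) r c (replicate (toℕ c) (suc w) ++ μ)
  glue w J<w r c m μ c+m<k C with split-top w μ (decreasing C) (largest C)
  ... | m₀ , ν , refl , ν<w with trans (sym (mult-top m₀ ν<w)) (multj C)
  ... | refl = record
    { decreasing = Linked-replicate-++ (toℕ c) (decreasing C) (All-map m≤n⇒m≤1+n (largest C))
    ; positive   = ++⁺ (replicate⁺ (toℕ c) (s≤s z≤n)) (positive C)
    ; gap        = Gap⇒GapAt (gap-prepend (toℕ c) (toℕ m) w ν (GapAt⇒Gap g _ (gap C)) ν<w (≤-pred c+m<k))
    ; smallest   = ++⁺ (replicate⁺ (toℕ c) (m≤n⇒m≤1+n J<w)) (smallest C)
    ; multJ+1    = subst (_≤ g ∸ toℕ r) (sym (mult-below (toℕ c) _ (top≢J+1 J<w))) (multJ+1 C)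
    ; largest    = ++⁺ (replicate⁺ (toℕ c) ≤-refl) (All-map m≤n⇒m≤1+n (largest C))
    ; multj      = mult-top (toℕ c) (All-map s≤s (largest C))
    }

  -- The level J + 1, where the multiplicity condition on J + 1 plays the role
  -- of the window condition against the row index r.
  peel-base : ∀ {w} → w ≡ J → ∀ r c λs → Counted k J (suc w) r c λs →
    λs ≡ replicate (toℕ c) (suc w) ++ [] × toℕ c + toℕ r < k
  peel-base refl r c λs C with split-top (suc J) λs (decreasing C) (largest C)
  ... | c₀ , x ∷ μ , refl , (x≤J ∷ _) =
    ⊥-elim (<⇒≱ x≤J (All-head (++⁻ʳ (replicate c₀ (suc J)) (smallest C))))
  ... | c₀ , [] , refl , [] with trans (sym (mult-top c₀ [])) (multj C)
  ... | refl = refl , s≤s (m≤o∸n⇒m+n≤o (toℕ c) (≤-pred (toℕ<n r)) c≤g∸r)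
    where
    c≤g∸r : toℕ c ≤ g ∸ toℕ r
    c≤g∸r = subst (_≤ g ∸ toℕ r) (mult-top (toℕ c) []) (multJ+1 C)

  glue-base : ∀ {w} → w ≡ J → ∀ r c → toℕ c + toℕ r < k →
    Counted k J (suc w) r c (replicate (toℕ c) (suc w) ++ [])
  glue-base refl r c c+r<k = record
    { decreasing = Linked-replicate-++ (toℕ c) [] []
    ; positive   = ++⁺ (replicate⁺ (toℕ c) (s≤s z≤n)) []
    ; gap        = Gap⇒GapAt (gap-prepend (toℕ c) 0 J [] [] [] c+0≤g)
    ; smallest   = ++⁺ (replicate⁺ (toℕ c) ≤-refl) []
    ; multJ+1    = subst (_≤ g ∸ toℕ r) (sym (mult-top (toℕ c) [])) (m+n≤o⇒m≤o∸n (toℕ c) (≤-pred c+r<k))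
    ; largest    = ++⁺ (replicate⁺ (toℕ c) ≤-refl) []
    ; multj      = mult-top (toℕ c) []
    }
    where
    c+0≤g : toℕ c + 0 ≤ g
    c+0≤g = ≤-trans (+-monoʳ-≤ (toℕ c) z≤n) (≤-pred c+r<k)

  part : ℕ → ℕ
  part d = suc (J + d)

  -- Entry d r c λs: λs is counted by the (r, c) entry of A_(J+1) ⋯ A_(J+d).
  -- For d = 0 (the identity matrix) this is the empty partition on the diagonal.
  Entry : ℕ → Fin k → Fin k → List ℕ → Set
  Entry zero    r c λs = λs ≡ [] × toℕ r ≡ toℕ c
  Entry (suc d) r c λs = Counted k J (part d) r c λs

  Entry-peel : ∀ d r c λs → Entry (suc d) r c λs →
    Σ (Fin k) λ m → Σ (List ℕ) λ μ →
      toℕ c + toℕ m < k × λs ≡ replicate (toℕ c) (part d) ++ μ × Entry d r m μ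
  Entry-peel zero r c λs C with peel-base (+-identityʳ J) r c λs C
  ... | λs≡ , c+r<k = r , [] , c+r<k , λs≡ , refl , refl
  Entry-peel (suc d) r c λs C with peel (J + suc d) (m<m+n J z<s) r c λs C
  ... | m , μ , c+m<k , λs≡ , Cμ = m , μ , c+m<k , λs≡ , subst (λ w → Counted k J w r m μ) (+-suc J d) Cμ

  Entry-glue : ∀ d r c m μ → toℕ c + toℕ m < k → Entry d r m μ →
    Entry (suc d) r c (replicate (toℕ c) (part d) ++ μ)
  Entry-glue zero r c m .[] c+m<k (refl , r≡m) =
    glue-base (+-identityʳ J) r c (subst (λ x → toℕ c + x < k) (sym r≡m) c+m<k)
  Entry-glue (suc d) r c m μ c+m<k C =
    glue (J + suc d) (m<m+n J z<s) r c m μ c+m<k (subst (λ w → Counted k J w r m μ) (sym (+-suc J d)) C)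

  Entry-top-unique : ∀ d r m₁ m₂ μ → Entry d r m₁ μ → Entry d r m₂ μ → m₁ ≡ m₂
  Entry-top-unique zero    r m₁ m₂ μ (_ , r≡m₁) (_ , r≡m₂) = toℕ-injective (trans (sym r≡m₁) r≡m₂)
  Entry-top-unique (suc d) r m₁ m₂ μ C₁ C₂ = toℕ-injective (trans (sym (multj C₁)) (multj C₂))

  mutual
    gen : ℕ → Fin k → Fin k → ℕ → List (List ℕ)
    gen zero    r c n = guard (toℕ r ≟ toℕ c) (guard (n ≟ 0) ([] ∷ []))
    gen (suc d) r c n = concatFin (extend d r c n)

    extend : ℕ → Fin k → Fin k → ℕ → Fin k → List (List ℕ)
    extend d r c n m = guard (toℕ c + toℕ m <? k) (guard (part d * toℕ c ≤? n)
      (map (replicate (toℕ c) (part d) ++_) (gen d r m (n ∸ part d * toℕ c))))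

  mutual
    length-gen : ∀ d r c n → length (gen d r c n) ≡ hprod k J d r c n
    length-gen zero    r c n = length-guard-series (toℕ r ≟ toℕ c) _ oneS n (length-guard (n ≟ 0) ([] ∷ []))
    length-gen (suc d) r c n =
      length-concatFin (extend d r c n) (λ m → hprod k J d r m *S A k (part d) m c) n (length-extend d r c n)

    length-extend : ∀ d r c n m → length (extend d r c n m) ≡ (hprod k J d r m *S A k (part d) m c) n
    length-extend d r c n m =
      length-guard-*S (toℕ c + toℕ m <? k) _ (hprod k J d r m) (monomial (part d * toℕ c)) n
        (length-guard-shift (part d * toℕ c ≤? n) _ (hprod k J d r m)
          (trans (length-map _ (gen d r m _)) (length-gen d r m (n ∸ part d * toℕ c))))

  extend-member : ∀ d r c n m λs → λs ∈ extend d r c n m →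
    Σ (List ℕ) λ μ → λs ≡ replicate (toℕ c) (part d) ++ μ × toℕ c + toℕ m < k ×
      part d * toℕ c ≤ n × μ ∈ gen d r m (n ∸ part d * toℕ c)
  extend-member d r c n m λs λs∈ with ∈-guard⁻ (toℕ c + toℕ m <? k) λs∈
  ... | c+m<k , λs∈′ with ∈-guard⁻ (part d * toℕ c ≤? n) λs∈′
  ... | e≤n , λs∈″ with ∈-map⁻ (replicate (toℕ c) (part d) ++_) λs∈″
  ... | μ , μ∈ , λs≡ = μ , λs≡ , c+m<k , e≤n , μ∈

  gen-sound : ∀ d r c n λs → λs ∈ gen d r c n → Entry d r c λs × sum λs ≡ n
  gen-sound zero r c n λs λs∈ with ∈-guard⁻ (toℕ r ≟ toℕ c) λs∈
  ... | r≡c , λs∈′ with ∈-guard⁻ (n ≟ 0) λs∈′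
  ... | n≡0 , here refl = (refl , r≡c) , sym n≡0
  gen-sound (suc d) r c n λs λs∈ with ∈-concatFin⁻ (extend d r c n) λs∈
  ... | m , λs∈′ with extend-member d r c n m λs λs∈′
  ... | μ , refl , c+m<k , e≤n , μ∈ with gen-sound d r m _ μ μ∈
  ... | Eμ , sumμ = Entry-glue d r c m μ c+m<k Eμ , (begin
    sum (replicate (toℕ c) (part d) ++ μ)  ≡⟨ sum-replicate-++ (toℕ c) (part d) μ ⟩
    part d * toℕ c + sum μ                 ≡⟨ cong (part d * toℕ c +_) sumμ ⟩
    part d * toℕ c + (n ∸ part d * toℕ c)  ≡⟨ m+[n∸m]≡n e≤n ⟩
    n                                      ∎)
    where open ≡-Reasoning

  gen-complete : ∀ d r c n λs → Entry d r c λs → sum λs ≡ n → λs ∈ gen d r c n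
  gen-complete zero r c n .[] (refl , r≡c) sum≡n =
    ∈-guard⁺ (toℕ r ≟ toℕ c) r≡c (∈-guard⁺ (n ≟ 0) (sym sum≡n) (here refl))
  gen-complete (suc d) r c n λs E sum≡n with Entry-peel d r c λs E
  ... | m , μ , c+m<k , refl , Eμ with +-split (part d * toℕ c) (sum μ) (trans (sym (sum-replicate-++ (toℕ c) (part d) μ)) sum≡n)
  ... | e≤n , sumμ = ∈-concatFin⁺ (extend d r c n) m
    (∈-guard⁺ (toℕ c + toℕ m <? k) c+m<k (∈-guard⁺ (part d * toℕ c ≤? n) e≤n
      (∈-map⁺ (replicate (toℕ c) (part d) ++_) (gen-complete d r m _ μ Eμ sumμ))))

  gen-unique : ∀ d r c n → Unique (gen d r c n)
  gen-unique zero    r c n = Unique-guard (toℕ r ≟ toℕ c) (Unique-guard (n ≟ 0) ([] ∷ []))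
  gen-unique (suc d) r c n = Unique-concatFin (extend d r c n) unique disjoint
    where
    unique : ∀ m → Unique (extend d r c n m)
    unique m = Unique-guard (toℕ c + toℕ m <? k) (Unique-guard (part d * toℕ c ≤? n)
      (Unique.map⁺ (λ {x} {y} → ++-cancelˡ (replicate (toℕ c) (part d)) x y)
        (gen-unique d r m (n ∸ part d * toℕ c))))
    disjoint : ∀ m₁ m₂ {λs} → λs ∈ extend d r c n m₁ → λs ∈ extend d r c n m₂ → m₁ ≡ m₂
    disjoint m₁ m₂ {λs} λs∈₁ λs∈₂ with extend-member d r c n m₁ λs λs∈₁ | extend-member d r c n m₂ λs λs∈₂
    ... | μ₁ , refl , _ , _ , μ₁∈ | μ₂ , λs≡ , _ , _ , μ₂∈ =
      Entry-top-unique d r m₁ m₂ μ₁ (proj₁ (gen-sound d r m₁ _ μ₁ μ₁∈))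
        (subst (Entry d r m₂) (sym (++-cancelˡ (replicate (toℕ c) (part d)) μ₁ μ₂ λs≡)) (proj₁ (gen-sound d r m₂ _ μ₂ μ₂∈)))

  enumeration : ∀ d r c n → Σ (List (List ℕ)) λ L →
    Unique L ×
    (∀ λs → (λs ∈ L) ⇔ (Counted k J (part d) r c λs × sum λs ≡ n)) ×
    hprod k J (suc d) r c n ≡ length L
  enumeration d r c n =
    gen (suc d) r c n , gen-unique (suc d) r c n ,
    (λ λs → mk⇔ (gen-sound (suc d) r c n λs) (uncurry (gen-complete (suc d) r c n λs))) ,
    sym (length-gen (suc d) r c n)

h-level : ∀ k J d → h k J (suc (J + d)) ≡ hprod k J (suc d)
h-level k J d = cong (hprod k J) (trans (cong (_∸ J) (sym (+-suc J d))) (m+n∸m≡n J (suc d)))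

propositionB2 : (k J j : ℕ) → 2 ≤ k → suc J ≤ j → (i l : Fin k) → (n : ℕ) →
    Σ (List (List ℕ)) (λ L →
      Unique L ×
      (∀ (λs : List ℕ) → (λs ∈ L) ⇔ (Counted k J j i l λs × sum λs ≡ n)) ×
      h k J j i l n ≡ length L)
propositionB2 (suc (suc g)) J j (s≤s (s≤s z≤n)) J<j i l n with m≤n⇒∃[o]m+o≡n J<j
... | d , refl with Enumeration.enumeration (suc g) J d i l n
... | L , unique , members , count =
  L , unique , members , trans (cong (λ M → M i l n) (h-level (suc (suc g)) J d)) count
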